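{- Let $G$ be a graph with a $(k,\rho)$-geodesic-cover $\mathcal{P}$, and let $\ell\in\{0,\dots,k\}$. Suppose $C$ and $D$ are two $\ell$-simplified $\rho$-snappaths (w.r.t. $\mathcal{P}$) with $\mathrm{Start}(C)=\mathrm{Start}(D)$, $\mathrm{type}(C)=\mathrm{type}(D)$, $\big||C|-|D|\big|\le\gamma$ for some non-negative integer $\gamma$, and such that the concatenations of $C$ and $D$ are $\delta$-almost shortest walks, where $\delta=4k\rho$. Then $\mathrm{dist}(\mathrm{End}(C),\mathrm{End}(D))\le\gamma+k(4k\rho+2\rho_\ell+2k\rho_\ell)+(6k+4)\rho_\ell$.
   Context: Graphs are finite, undirected and unweighted, with shortest-path distance $\mathrm{dist}$. A walk is a sequence of vertices with consecutive vertices adjacent; its length is its number of steps. A walk $W$ is $\delta$-almost shortest if $\big||W|-\mathrm{dist}(\mathrm{Start}(W),\mathrm{End}(W))\big|\le\delta$. A geodesic is a shortest path between its endpoints; each geodesic is considered with a fixed direction from its start to its end. A $(k,\rho)$-geodesic-cover of $G$ is a family $\mathcal{P}$ of $k$ geodesics such that every vertex is at distance at most $\rho$ from some vertex of a path in $\mathcal{P}$. Define $\rho_0=2\rho+1$ and $\rho_i=(2k+5)\rho_{i-1}$ for $i=1,\dots,k$. An $\ell$-simplified $\rho$-snappath is a sequence $(R_0,Q_1,R_1,\dots,Q_{k'},R_{k'})$ of walks with $\mathrm{End}(R_{i-1})=\mathrm{Start}(Q_i)$ and $\mathrm{End}(Q_i)=\mathrm{Start}(R_i)$ ($k'=0$ allowed),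 such that each $Q_i$ is a subpath of a geodesic in $\mathcal{P}$, each geodesic of $\mathcal{P}$ contains at most one $Q_i$ as a subpath, every $R_i$ has length at most $\rho_\ell$, and every $Q_i$ has length larger than $(2k+3)\rho_\ell$. Its length, start and end are those of the concatenation $R_0\cdot Q_1\cdots Q_{k'}\cdot R_{k'}$. Its type is the tuple $(\overline{P}_1,\dots,\overline{P}_{k'},\ell)$, where $P_i\in\mathcal{P}$ is the geodesic containing $Q_i$ and $\overline{P}_i$ records $P_i$ together with whether $Q_i$ traverses $P_i$ forwards or backwards. -}

module Defs where

open import Data.Nat using (ℕ; zero; suc; _+_; _*_; _≤_; _<_; ∣_-_∣)
open import Data.Fin using (Fin; zero; suc; inject₁; fromℕ)
open import Data.List using (List; []; _∷_; _++_; length; reverse)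
open import Data.List.Membership.Propositional using (_∈_)
open import Data.Product using (Σ; ∃; _×_; _,_)
open import Data.Unit using (⊤)
open import Data.Empty using (⊥)
open import Relation.Nullary using (¬_)
open import Relation.Binary.PropositionalEquality using (_≡_)

record Graph : Set₁ where
  field
    n     : ℕ
    Adj   : Fin n → Fin n → Set
    sym   : ∀ {u v} → Adj u v → Adj v u
    irrefl : ∀ {u} → ¬ Adj u u

rhoSeq : ℕ → ℕ → ℕ → ℕ
rhoSeq k ρ zero    = 2 * ρ + 1
rhoSeq k ρ (suc i) = (2 * k + 5) * rhoSeq k ρ i

sumFin : (m : ℕ) → (Fin m → ℕ) → ℕ
sumFin zero    f = 0
sumFin (suc m) f = f zero + sumFin m (λ i → f (suc i))

module _ (G : Graph) where
  open Graph G

  V : Set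
  V = Fin n

  IsWalkFrom : V → List V → Set
  IsWalkFrom x []       = ⊤
  IsWalkFrom x (y ∷ ys) = Adj x y × IsWalkFrom y ys

  record Walk : Set where
    constructor walk
    field
      start : V
      rest  : List V
      valid : IsWalkFrom start rest

  lastFrom : V → List V → V
  lastFrom x []       = x
  lastFrom x (y ∷ ys) = lastFrom y ys

  Start : Walk → V
  Start w = Walk.start w

  End : Walk → V
  End w = lastFrom (Walk.start w) (Walk.rest w)

  len : Walk → ℕ
  len w = length (Walk.rest w)

  vertices : Walk → List V
  vertices w = Walk.start w ∷ Walk.rest w

  IsDist : V → V → ℕ → Set
  IsDist u v d =
    (Σ Walk λ w → Start w ≡ u × End w ≡ v × len w ≡ d)
    × (∀ (w : Walk) → Start w ≡ u → End w ≡ v → d ≤ len w)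

  DistLe : V → V → ℕ → Set
  DistLe u v d = Σ Walk λ w → Start w ≡ u × End w ≡ v × len w ≤ d

  -- W is δ-almost shortest (given by its start, end and length)
  AlmostShortest : ℕ → V → V → ℕ → Set
  AlmostShortest δ s e l = ∃ λ d → IsDist s e d × ∣ l - d ∣ ≤ δ

  IsGeodesic : Walk → Set
  IsGeodesic w = IsDist (Start w) (End w) (len w)

  Infix : List V → List V → Set
  Infix xs ys = ∃ λ as → ∃ λ bs → ys ≡ as ++ (xs ++ bs)

  data Dir : Set where
    fwd bwd : Dir

  SubpathDir : Dir → Walk → Walk → Set
  SubpathDir fwd Q P = Infix (vertices Q) (vertices P)
  SubpathDir bwd Q P = Infix (vertices Q) (reverse (vertices P))

  Subpath : Walk → Walk → Set
  Subpath Q P = ∃ λ dir → SubpathDir dir Q P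

  record GeodesicCover (k ρ : ℕ) : Set where
    field
      path      : Fin k → Walk
      geodesic  : ∀ i → IsGeodesic (path i)
      covers    : ∀ (v : V) → ∃ λ i → ∃ λ u → u ∈ vertices (path i) × DistLe v u ρ

  -- An ℓ-simplified ρ-snappath w.r.t. a cover 𝒫, with its type recorded in `type`
  -- (the list of (index of P_i in 𝒫, direction of traversal)); the ℓ component of the
  -- type is the parameter ℓ.
  record Snappath {k ρ : ℕ} (𝒫 : GeodesicCover k ρ) (ℓ : ℕ) : Set where
    open GeodesicCover 𝒫
    field
      type     : List (Fin k × Dir)
    k′ : ℕ
    k′ = length type
    field
      R        : Fin (suc k′) → Walk
      Q        : Fin k′ → Walk
      linkIn   : ∀ (i : Fin k′) → End (R (inject₁ i)) ≡ Start (Q i)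
      linkOut  : ∀ (i : Fin k′) → End (Q i) ≡ Start (R (suc i))
      onPath   : ∀ (i : Fin k′) → ∀ p dir → Data.List.lookup type i ≡ (p , dir)
                   → SubpathDir dir (Q i) (path p)
      atMostOne : ∀ (p : Fin k) (i j : Fin k′) → Subpath (Q i) (path p) → Subpath (Q j) (path p) → i ≡ j
      shortR   : ∀ (i : Fin (suc k′)) → len (R i) ≤ rhoSeq k ρ ℓ
      longQ    : ∀ (i : Fin k′) → (2 * k + 3) * rhoSeq k ρ ℓ < len (Q i)

    -- start, end and length of the concatenation R_0·Q_1·…·Q_k′·R_k′
    sStart : V
    sStart = Start (R zero)

    sEnd : V
    sEnd = End (R (fromℕ k′))

    sLen : ℕ
    sLen = sumFin (suc k′) (λ i → len (R i)) + sumFin k′ (λ i → len (Q i))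

{-# OPTIONS --safe #-}
-- Follow C and D hop by hop. A runner on a snappath records the length of the prefix walked so far
-- and of some walk from the common start s to its current vertex (its shortcut); as the whole
-- snappath is δ-almost shortest, so is every prefix. After both runners have left the i-th geodesic
-- of their common type at positions pX and pY, their shortcuts measured relative to these positions
-- differ by at most 2iρℓ. On the next geodesic, if one route starts before the other ends, the
-- latter runner can reuse the former's shortcut and the lag drops to 0. Otherwise the entry
-- positions, at most ρℓ + gap + ρℓ apart along a geodesic, raise the lag by at most 2ρℓ, except in
-- one configuration where a route, being longer than (2k+3)ρℓ, would be a detour too long for an
-- almost shortest walk. At the end, the two final walks and the gap between the last exits give
-- the bound γ + δ + 2kρℓ + 2ρℓ, which is below the stated one.
module Submission where

open import Defs
open import Data.Nat using (ℕ; zero; suc; _+_; _*_; _≤_; _<_; _∸_; z≤n; s≤s; ∣_-_∣)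
open import Data.Nat.Properties
open import Data.Nat.Tactic.RingSolver using (solve-∀; solve)
open import Data.Fin using (Fin; zero; suc; inject₁; fromℕ)
open import Data.Fin.Properties using (pigeonhole) renaming (<-irrefl to Fin-<-irrefl)
open import Data.List using (List; []; _∷_; _++_; length; reverse; [_])
import Data.List as List
open import Data.List.Properties using (length-++; unfold-reverse)
open import Data.Product using (Σ; ∃; _×_; _,_; proj₁; proj₂)
open import Data.Sum using (_⊎_; inj₁; inj₂) renaming (swap to ⊎-swap)
open import Data.Unit using (tt)
open import Data.Empty using (⊥-elim)
open import Function using (_∘_)
open import Algebra.Properties.CommutativeSemigroup +-commutativeSemigroup using (interchange; xy∙z≈xz∙y)
open import Relation.Nullary using (¬_)
open import Relation.Nullary.Decidable using (decidable-stable)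
open import Relation.Binary.PropositionalEquality using (_≡_; refl; sym; trans; cong; subst; subst₂)

difference : ∀ m n → (∃ λ d → m + d ≡ n) ⊎ (∃ λ d → n + d ≡ m)
difference m n with ≤-total m n
... | inj₁ m≤n = inj₁ (m≤n⇒∃[o]m+o≡n m≤n)
... | inj₂ n≤m = inj₂ (m≤n⇒∃[o]m+o≡n n≤m)

-- Lag M e p e′ p′ says e - p ≤ e′ - p′ + M, stated without truncated subtraction.
record Lag (M e p e′ p′ : ℕ) : Set where
  constructor lag
  field
    lag-≤ : e + p′ ≤ e′ + p + M

Lag-refl : ∀ M e p → Lag M e p e p
Lag-refl M e p = lag (m≤m+n (e + p) M)

Lag-mono : ∀ {M M′ e p e′ p′} → M ≤ M′ → Lag M e p e′ p′ → Lag M′ e p e′ p′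
Lag-mono {p = p} {e′ = e′} M≤M′ (lag ≤M) = lag (≤-trans ≤M (+-monoʳ-≤ (e′ + p) M≤M′))

Lag-total : ∀ e p e′ p′ → Lag 0 e p e′ p′ ⊎ Lag 0 e′ p′ e p
Lag-total e p e′ p′ with ≤-total (e + p′) (e′ + p)
... | inj₁ le = inj₁ (lag (≤-trans le (m≤m+n _ 0)))
... | inj₂ ge = inj₂ (lag (≤-trans ge (m≤m+n _ 0)))

Lag-shift : ∀ {M e p e′ p′} q q′ → Lag M e p e′ p′ → Lag M (e + q) (p + q) (e′ + q′) (p′ + q′)
Lag-shift {M} {e} {p} {e′} {p′} q q′ (lag ≤M) = lag (begin
  e + q + (p′ + q′)     ≡⟨ solve (e ∷ q ∷ p′ ∷ q′ ∷ []) ⟩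
  e + p′ + (q + q′)     ≤⟨ +-monoˡ-≤ (q + q′) ≤M ⟩
  e′ + p + M + (q + q′) ≡⟨ solve (e′ ∷ p ∷ M ∷ q ∷ q′ ∷ []) ⟩
  e′ + q′ + (p + q) + M ∎)
  where open ≤-Reasoning

Lag-gap : ∀ {M e p e′ g} → Lag M e p e′ (p + g) → e + g ≤ e′ + M
Lag-gap {M} {e} {p} {e′} {g} (lag ≤M) = +-cancelˡ-≤ p (e + g) (e′ + M) (begin
  p + (e + g)   ≡⟨ solve (p ∷ e ∷ g ∷ []) ⟩
  e + (p + g)   ≤⟨ ≤M ⟩
  e′ + p + M    ≡⟨ solve (e′ ∷ p ∷ M ∷ []) ⟩
  p + (e′ + M)  ∎)
  where open ≤-Reasoning

Lag-across-approach : ∀ {M R e e′ r r′ a a′ g} → a ≤ a′ + (r′ + g + r) → e′ + g ≤ e + M → r′ ≤ R →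
  Lag (2 * R + M) (e′ + r′) a′ (e + r) a
Lag-across-approach {M} {R} {e} {e′} {r} {r′} {a} {a′} {g} geodesic gap r′≤R = lag (begin
  e′ + r′ + a                   ≤⟨ +-monoʳ-≤ (e′ + r′) geodesic ⟩
  e′ + r′ + (a′ + (r′ + g + r)) ≡⟨ solve (e′ ∷ r′ ∷ a′ ∷ g ∷ r ∷ []) ⟩
  e′ + g + (r′ + r′) + (r + a′) ≤⟨ +-monoˡ-≤ (r + a′) (+-mono-≤ gap (+-mono-≤ r′≤R r′≤R)) ⟩
  e + M + (R + R) + (r + a′)    ≡⟨ solve (e ∷ M ∷ R ∷ r ∷ a′ ∷ []) ⟩
  e + r + a′ + (2 * R + M)      ∎)
  where open ≤-Reasoning

route-bounded : ∀ {M R δ e e′ r r′ a′ q′ d g} → a′ + q′ + d ≤ a′ + (r′ + g + r) → e + g ≤ e′ + M →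
  e′ + r′ + q′ ≤ e + r + d + δ → r ≤ R → q′ + q′ ≤ 2 * R + M + δ
route-bounded {M} {R} {δ} {e} {e′} {r} {r′} {a′} {q′} {d} {g} geodesic gap detour r≤R =
  +-cancelʳ-≤ (e′ + r′ + d) (q′ + q′) (2 * R + M + δ) (begin
    q′ + q′ + (e′ + r′ + d)         ≡⟨ solve (q′ ∷ e′ ∷ r′ ∷ d ∷ []) ⟩
    e′ + r′ + q′ + (q′ + d)         ≤⟨ +-mono-≤ detour q′+d≤ ⟩
    e + r + d + δ + (r′ + g + r)    ≡⟨ solve (e ∷ r ∷ d ∷ δ ∷ r′ ∷ g ∷ []) ⟩
    e + g + (r + r) + (r′ + d + δ)  ≤⟨ +-monoˡ-≤ (r′ + d + δ) (+-mono-≤ gap (+-mono-≤ r≤R r≤R)) ⟩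
    e′ + M + (R + R) + (r′ + d + δ) ≡⟨ solve (e′ ∷ M ∷ R ∷ r′ ∷ d ∷ δ ∷ []) ⟩
    2 * R + M + δ + (e′ + r′ + d)   ∎)
  where
  open ≤-Reasoning
  q′+d≤ : q′ + d ≤ r′ + g + r
  q′+d≤ = +-cancelˡ-≤ a′ (q′ + d) (r′ + g + r) (subst (_≤ a′ + (r′ + g + r)) (+-assoc a′ q′ d) geodesic)

shortcut-via-ahead : ∀ {e e′ t′ r r′ a a′ q′ d} → Lag 0 (e + r) a (e′ + r′) a′ → a + d ≡ a′ + q′ → e′ ≤ t′ →
  e + r + d ≤ t′ + r′ + q′
shortcut-via-ahead {e} {e′} {t′} {r} {r′} {a} {a′} {q′} {d} (lag ahead) a+d e′≤t′ =
  +-cancelʳ-≤ a′ (e + r + d) (t′ + r′ + q′) (begin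
    e + r + d + a′      ≡⟨ solve (e ∷ r ∷ d ∷ a′ ∷ []) ⟩
    e + r + a′ + d      ≤⟨ +-monoˡ-≤ d ahead ⟩
    e′ + r′ + a + 0 + d ≡⟨ solve (e′ ∷ r′ ∷ a ∷ d ∷ []) ⟩
    e′ + r′ + (a + d)   ≡⟨ cong (e′ + r′ +_) a+d ⟩
    e′ + r′ + (a′ + q′) ≤⟨ +-monoˡ-≤ (a′ + q′) (+-monoˡ-≤ r′ e′≤t′) ⟩
    t′ + r′ + (a′ + q′) ≡⟨ solve (t′ ∷ r′ ∷ a′ ∷ q′ ∷ []) ⟩
    t′ + r′ + q′ + a′   ∎)
  where open ≤-Reasoning

final-gap : ∀ {M R γ δ e e′ t t′ r r′ g} → e + g ≤ e′ + M → e′ ≤ t′ → t ≤ e + δ →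
  t′ + r′ ≤ t + r + γ → r ≤ R → r + g + r′ ≤ γ + δ + M + 2 * R
final-gap {M} {R} {γ} {δ} {e} {e′} {t} {t′} {r} {r′} {g} gap e′≤t′ t≤e+δ lengths r≤R =
  +-cancelʳ-≤ e (r + g + r′) (γ + δ + M + 2 * R) (begin
    r + g + r′ + e            ≡⟨ solve (r ∷ g ∷ r′ ∷ e ∷ []) ⟩
    e + g + (r + r′)          ≤⟨ +-monoˡ-≤ (r + r′) (≤-trans gap (+-monoˡ-≤ M e′≤t′)) ⟩
    t′ + M + (r + r′)         ≡⟨ solve (t′ ∷ M ∷ r ∷ r′ ∷ []) ⟩
    t′ + r′ + (r + M)         ≤⟨ +-monoˡ-≤ (r + M) lengths ⟩
    t + r + γ + (r + M)       ≤⟨ +-monoˡ-≤ (r + M) (+-monoˡ-≤ γ (+-monoˡ-≤ r t≤e+δ)) ⟩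
    e + δ + r + γ + (r + M)   ≡⟨ solve (e ∷ δ ∷ r ∷ γ ∷ M ∷ []) ⟩
    γ + δ + M + (r + r) + e   ≤⟨ +-monoˡ-≤ e (+-monoʳ-≤ (γ + δ + M) (+-mono-≤ r≤R r≤R)) ⟩
    γ + δ + M + (R + R) + e   ≡⟨ solve (γ ∷ δ ∷ M ∷ R ∷ e ∷ []) ⟩
    γ + δ + M + 2 * R + e     ∎)
  where open ≤-Reasoning

lag-room : ∀ {i k R δ} → suc i ≤ k → δ ≤ 2 * k * R → suc i * (2 * R) + δ ≤ (2 * k + 3) * R + (2 * k + 3) * R
lag-room {i} {k} {R} {δ} i<k δ≤ = begin
  suc i * (2 * R) + δ              ≤⟨ +-mono-≤ (*-monoˡ-≤ (2 * R) i<k) δ≤ ⟩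
  k * (2 * R) + 2 * k * R          ≤⟨ m≤m+n _ (6 * R) ⟩
  k * (2 * R) + 2 * k * R + 6 * R  ≡⟨ solve (k ∷ R ∷ []) ⟩
  (2 * k + 3) * R + (2 * k + 3) * R ∎
  where open ≤-Reasoning

corollary-bound : ∀ {γ k ρ R} → 4 * k * ρ ≤ 2 * k * R →
  γ + 4 * k * ρ + k * (2 * R) + 2 * R ≤ γ + k * (4 * k * ρ + 2 * R + 2 * k * R) + (6 * k + 4) * R
corollary-bound {γ} {k} {ρ} {R} δ≤ = begin
  γ + 4 * k * ρ + k * (2 * R) + 2 * R                   ≤⟨ +-monoˡ-≤ (2 * R) (+-monoˡ-≤ (k * (2 * R)) (+-monoʳ-≤ γ δ≤)) ⟩
  γ + 2 * k * R + k * (2 * R) + 2 * R                   ≤⟨ m≤m+n _ (2 * k * R + 2 * R) ⟩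
  γ + 2 * k * R + k * (2 * R) + 2 * R + (2 * k * R + 2 * R) ≡⟨ solve (γ ∷ k ∷ R ∷ []) ⟩
  γ + (6 * k + 4) * R                                   ≤⟨ +-monoˡ-≤ ((6 * k + 4) * R) (m≤m+n γ _) ⟩
  γ + k * (4 * k * ρ + 2 * R + 2 * k * R) + (6 * k + 4) * R ∎
  where open ≤-Reasoning

rhoSeq-≥ : ∀ k ρ ℓ → 2 * ρ + 1 ≤ rhoSeq k ρ ℓ
rhoSeq-≥ k ρ zero    = ≤-refl
rhoSeq-≥ k ρ (suc ℓ) = ≤-trans (rhoSeq-≥ k ρ ℓ) (subst (_≤ (2 * k + 5) * ρℓ) (*-identityˡ ρℓ)
                                                  (*-monoˡ-≤ ρℓ (≤-trans (s≤s z≤n) (m≤n+m 5 (2 * k)))))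
  where
  ρℓ : ℕ
  ρℓ = rhoSeq k ρ ℓ

4kρ≤2kρℓ : ∀ k ρ ℓ → 4 * k * ρ ≤ 2 * k * rhoSeq k ρ ℓ
4kρ≤2kρℓ k ρ ℓ = begin
  4 * k * ρ           ≡⟨ solve (k ∷ ρ ∷ []) ⟩
  2 * k * (2 * ρ)     ≤⟨ *-monoʳ-≤ (2 * k) (≤-trans (m≤m+n (2 * ρ) 1) (rhoSeq-≥ k ρ ℓ)) ⟩
  2 * k * rhoSeq k ρ ℓ ∎
  where open ≤-Reasoning

module Walks (G : Graph) where
  open Graph G using (Adj) renaming (sym to Adj-sym)

  edge : ∀ {x y} → Adj x y → Walk G
  edge {x} {y} a = walk x [ y ] (a , tt)

  IsWalkFrom-++ : ∀ x (xs ys : List (V G)) →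
    IsWalkFrom G x xs → IsWalkFrom G (lastFrom G x xs) ys → IsWalkFrom G x (xs ++ ys)
  IsWalkFrom-++ x []       ys _       w = w
  IsWalkFrom-++ x (y ∷ xs) ys (a , v) w = a , IsWalkFrom-++ y xs ys v w

  lastFrom-++ : ∀ x (xs ys : List (V G)) → lastFrom G x (xs ++ ys) ≡ lastFrom G (lastFrom G x xs) ys
  lastFrom-++ x []       ys = refl
  lastFrom-++ x (y ∷ xs) ys = lastFrom-++ y xs ys

  concat : (w₁ w₂ : Walk G) → End G w₁ ≡ Start G w₂ → Walk G
  concat (walk x xs v) (walk y ys w) eq =
    walk x (xs ++ ys) (IsWalkFrom-++ x xs ys v (subst (λ z → IsWalkFrom G z ys) (sym eq) w))

  concat-end : ∀ w₁ w₂ eq → End G (concat w₁ w₂ eq) ≡ End G w₂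
  concat-end (walk x xs _) (walk y ys _) eq = trans (lastFrom-++ x xs ys) (cong (λ z → lastFrom G z ys) eq)

  concat-len : ∀ w₁ w₂ eq → len G (concat w₁ w₂ eq) ≡ len G w₁ + len G w₂
  concat-len (walk _ xs _) _ _ = length-++ xs

  mutual
    reverseFrom : ∀ x (xs : List (V G)) → IsWalkFrom G x xs → Walk G
    reverseFrom x []       _       = walk x [] tt
    reverseFrom x (y ∷ ys) (a , v) =
      concat (reverseFrom y ys v) (edge (Adj-sym a)) (reverseFrom-end y ys v)

    reverseFrom-end : ∀ x xs v → End G (reverseFrom x xs v) ≡ x
    reverseFrom-end x []       _       = refl
    reverseFrom-end x (y ∷ ys) (a , v) =
      concat-end (reverseFrom y ys v) (edge (Adj-sym a)) (reverseFrom-end y ys v)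

  reverseᵂ : Walk G → Walk G
  reverseᵂ (walk x xs v) = reverseFrom x xs v

  reverseᵂ-end : ∀ w → End G (reverseᵂ w) ≡ Start G w
  reverseᵂ-end (walk x xs v) = reverseFrom-end x xs v

  reverseᵂ-start : ∀ w → Start G (reverseᵂ w) ≡ End G w
  reverseᵂ-start (walk x xs v) = go x xs v
    where
    go : ∀ x xs v → Start G (reverseFrom x xs v) ≡ lastFrom G x xs
    go x []       _       = refl
    go x (y ∷ ys) (a , v) = go y ys v

  reverseᵂ-len : ∀ w → len G (reverseᵂ w) ≡ len G w
  reverseᵂ-len (walk x xs v) = go x xs v
    where
    go : ∀ x xs v → len G (reverseFrom x xs v) ≡ length xs
    go x []       _       = refl
    go x (y ∷ ys) (a , v) = trans (length-++ (Walk.rest (reverseFrom y ys v)))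
                                  (trans (cong (_+ 1) (go y ys v)) (+-comm (length ys) 1))

  reverseᵂ-vertices : ∀ w → vertices G (reverseᵂ w) ≡ reverse (vertices G w)
  reverseᵂ-vertices (walk x xs v) = go x xs v
    where
    go : ∀ x xs v → vertices G (reverseFrom x xs v) ≡ reverse (x ∷ xs)
    go x []       _       = refl
    go x (y ∷ ys) (a , v) = trans (cong (_++ [ x ]) (go y ys v)) (sym (unfold-reverse x (y ∷ ys)))

  DistLe-refl : ∀ u → DistLe G u u 0
  DistLe-refl u = walk u [] tt , refl , refl , z≤n

  DistLe-walk : (w : Walk G) → DistLe G (Start G w) (End G w) (len G w)
  DistLe-walk w = w , refl , refl , ≤-refl

  DistLe-trans : ∀ {u v w m n} → DistLe G u v m → DistLe G v w n → DistLe G u w (m + n)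
  DistLe-trans {m = m} {n} (w₁ , refl , refl , l₁) (w₂ , s₂ , refl , l₂) =
    concat w₁ w₂ (sym s₂) , refl , concat-end w₁ w₂ (sym s₂) ,
    subst (_≤ m + n) (sym (concat-len w₁ w₂ (sym s₂))) (+-mono-≤ l₁ l₂)

  DistLe-sym : ∀ {u v n} → DistLe G u v n → DistLe G v u n
  DistLe-sym (w , refl , refl , l) =
    reverseᵂ w , reverseᵂ-start w , reverseᵂ-end w , subst (_≤ _) (sym (reverseᵂ-len w)) l

  DistLe-mono : ∀ {u v m n} → m ≤ n → DistLe G u v m → DistLe G u v n
  DistLe-mono m≤n (w , s , e , l) = w , s , e , ≤-trans l m≤n

  IsDist-minimal : ∀ {u v d n} → IsDist G u v d → DistLe G u v n → d ≤ n
  IsDist-minimal (_ , minimal) (w , s , e , l) = ≤-trans (minimal w s e) l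

  AlmostShortest-≤ : ∀ {δ u v l n} → AlmostShortest G δ u v l → DistLe G u v n → l ≤ n + δ
  AlmostShortest-≤ {l = l} (d , isDist , l≈d) uv =
    ≤-trans (m≤n+∣m-n∣ l d) (+-mono-≤ (IsDist-minimal isDist uv) l≈d)

  reverseᵂ-geodesic : ∀ w → IsGeodesic G w → IsGeodesic G (reverseᵂ w)
  reverseᵂ-geodesic w (_ , minimal) =
    (reverseᵂ w , refl , refl , refl) , λ w′ s e →
      subst₂ _≤_ (sym (reverseᵂ-len w)) (reverseᵂ-len w′)
        (minimal (reverseᵂ w′) (trans (reverseᵂ-start w′) (trans e (reverseᵂ-end w)))
                               (trans (reverseᵂ-end w′) (trans s (reverseᵂ-start w))))

  vertexAt : V G → List (V G) → ℕ → V G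
  vertexAt x _        zero    = x
  vertexAt x []       (suc i) = x
  vertexAt x (y ∷ ys) (suc i) = vertexAt y ys i

  vertexAt-length : ∀ x xs → vertexAt x xs (length xs) ≡ lastFrom G x xs
  vertexAt-length x []       = refl
  vertexAt-length x (y ∷ ys) = vertexAt-length y ys

  vertexAt-++ : ∀ x xs ys i → i ≤ length xs → vertexAt x (xs ++ ys) i ≡ vertexAt x xs i
  vertexAt-++ x xs       ys zero    _         = refl
  vertexAt-++ x (y ∷ xs) ys (suc i) (s≤s i≤n) = vertexAt-++ y xs ys i i≤n

  vertexAt-after : ∀ x as y ys i → vertexAt x (as ++ y ∷ ys) (suc (length as + i)) ≡ vertexAt y ys i
  vertexAt-after x []       y ys i = refl
  vertexAt-after x (z ∷ as) y ys i = vertexAt-after z as y ys i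

  vertexAt-infix : ∀ {x xs y} {ys : List (V G)} as → x ∷ xs ≡ as ++ y ∷ ys →
    ∀ i → vertexAt x xs (length as + i) ≡ vertexAt y ys i
  vertexAt-infix []       refl i = refl
  vertexAt-infix (z ∷ as) refl i = vertexAt-after z as _ _ i

  length-infix : ∀ {x xs y} {ys : List (V G)} as → x ∷ xs ≡ as ++ y ∷ ys → length xs ≡ length as + length ys
  length-infix []       refl = refl
  length-infix (z ∷ as) refl = trans (length-++ as) (+-suc (length as) _)

  prefix-DistLe : ∀ x xs → IsWalkFrom G x xs → ∀ d → d ≤ length xs → DistLe G x (vertexAt x xs d) d
  prefix-DistLe x xs       _       zero    _         = DistLe-refl x
  prefix-DistLe x (y ∷ ys) (a , v) (suc d) (s≤s d≤n) with prefix-DistLe y ys v d d≤n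
  ... | walk .y zs w , refl , e , l = walk x (y ∷ zs) (a , w) , refl , e , s≤s l

  infix-DistLe : ∀ x xs → IsWalkFrom G x xs →
    ∀ i d → i + d ≤ length xs → DistLe G (vertexAt x xs i) (vertexAt x xs (i + d)) d
  infix-DistLe x xs       v       zero    d fits      = prefix-DistLe x xs v d fits
  infix-DistLe x (y ∷ ys) (_ , v) (suc i) d (s≤s fits) = infix-DistLe y ys v i d fits

  record GeodesicLine : Set where
    field
      size        : ℕ
      at          : ℕ → V G
      along       : ∀ x d → x + d ≤ size → DistLe G (at x) (at (x + d)) d
      no-shortcut : ∀ {x y n} → x ≤ size → y ≤ size → DistLe G (at x) (at y) n → y ≤ x + n

    gap : ∀ {x y} → x ≤ size → y ≤ size → ∃ λ g → DistLe G (at x) (at y) g × (y ≡ x + g ⊎ x ≡ y + g)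
    gap {x} {y} x≤size y≤size with difference x y
    ... | inj₁ (g , refl) = g , along x g y≤size , inj₁ refl
    ... | inj₂ (g , refl) = g , DistLe-sym (along y g x≤size) , inj₂ refl

  geodesic-line : (W : Walk G) → IsGeodesic G W → GeodesicLine
  geodesic-line (walk x xs v) geo = record
    { size        = length xs
    ; at          = vertexAt x xs
    ; along       = infix-DistLe x xs v
    ; no-shortcut = no-shortcut
    }
    where
    no-shortcut : ∀ {a b n} → a ≤ length xs → b ≤ length xs →
      DistLe G (vertexAt x xs a) (vertexAt x xs b) n → b ≤ a + n
    no-shortcut {a} {b} {n} a≤size b≤size ab = +-cancelʳ-≤ rest b (a + n) (begin
      b + rest         ≡⟨ b+rest ⟩
      length xs        ≤⟨ IsDist-minimal geo through ⟩
      a + n + rest     ∎)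
      where
      open ≤-Reasoning
      rest : ℕ
      rest = length xs ∸ b
      b+rest : b + rest ≡ length xs
      b+rest = m+[n∸m]≡n b≤size
      to-end : DistLe G (vertexAt x xs b) (lastFrom G x xs) rest
      to-end = subst (λ i → DistLe G (vertexAt x xs b) i rest) (trans (cong (vertexAt x xs) b+rest) (vertexAt-length x xs))
                 (infix-DistLe x xs v b rest (≤-reflexive b+rest))
      through : DistLe G x (lastFrom G x xs) (a + n + rest)
      through = DistLe-trans (DistLe-trans (prefix-DistLe x xs v a a≤size) ab) to-end

  record Segment (Λ : GeodesicLine) (Q : Walk G) : Set where
    open GeodesicLine Λ
    field
      entry       : ℕ
      entry-point : at entry ≡ Start G Q
      exit-point  : at (entry + len G Q) ≡ End G Q
      fits        : entry + len G Q ≤ size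

  segment : ∀ {Q} W (geo : IsGeodesic G W) → Infix G (vertices G Q) (vertices G W) → Segment (geodesic-line W geo) Q
  segment {walk q qs _} (walk x xs _) _ (as , bs , eq) = record
    { entry       = length as
    ; entry-point = trans (cong (vertexAt x xs) (sym (+-identityʳ (length as)))) (vertexAt-infix as eq 0)
    ; exit-point  = trans (vertexAt-infix as eq (length qs))
                          (trans (vertexAt-++ q qs bs (length qs) ≤-refl) (vertexAt-length q qs))
    ; fits        = begin
        length as + length qs               ≤⟨ +-monoʳ-≤ (length as) (m≤m+n (length qs) (length bs)) ⟩
        length as + (length qs + length bs) ≡⟨ cong (length as +_) (length-++ qs) ⟨
        length as + length (qs ++ bs)       ≡⟨ length-infix as eq ⟨
        length xs                           ∎
    }
    where open ≤-Reasoning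

module Chains (G : Graph) {k ρ : ℕ} (𝒫 : GeodesicCover G k ρ) (ℓ : ℕ) where
  open Walks G
  open GeodesicCover 𝒫

  ρℓ : ℕ
  ρℓ = rhoSeq k ρ ℓ

  line : Fin k → Dir G → GeodesicLine
  line p fwd = geodesic-line (path p) (geodesic p)
  line p bwd = geodesic-line (reverseᵂ (path p)) (reverseᵂ-geodesic (path p) (geodesic p))

  segmentOf : ∀ {Q} p dir → SubpathDir G dir Q (path p) → Segment (line p dir) Q
  segmentOf p fwd Q⊆P = segment (path p) (geodesic p) Q⊆P
  segmentOf p bwd Q⊆P = segment (reverseᵂ (path p)) (reverseᵂ-geodesic (path p) (geodesic p))
                          (subst (Infix G _) (sym (reverseᵂ-vertices (path p))) Q⊆P)

  record Hop (u v : V G) (p : Fin k) (dir : Dir G) : Set where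
    field
      approach route : Walk G
      approach-start : Start G approach ≡ u
      joins          : End G approach ≡ Start G route
      route-end      : End G route ≡ v
      on-path        : SubpathDir G dir route (path p)
      approach-short : len G approach ≤ ρℓ
      route-long     : (2 * k + 3) * ρℓ < len G route

    placement : Segment (line p dir) route
    placement = segmentOf p dir on-path

    entry : ℕ
    entry = Segment.entry placement

    approach-DistLe : DistLe G u (GeodesicLine.at (line p dir) entry) (len G approach)
    approach-DistLe = approach , approach-start , trans joins (sym (Segment.entry-point placement)) , ≤-refl

    route-exit : GeodesicLine.at (line p dir) (entry + len G route) ≡ v
    route-exit = trans (Segment.exit-point placement) route-end

  -- The snappath R₀ Q₁ R₁ … Q_k′ R_k′ as the hops (Rᵢ₋₁, Qᵢ) followed by R_k′. The condition that
  -- each geodesic is used at most once is dropped: it only serves to bound k′ by k (length-type≤k).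
  data Chain : V G → List (Fin k × Dir G) → Set where
    final : ∀ {u} (r : Walk G) → Start G r ≡ u → len G r ≤ ρℓ → Chain u []
    _∷_   : ∀ {u v p dir ts} → Hop u v p dir → Chain v ts → Chain u ((p , dir) ∷ ts)

  chainEnd : ∀ {u ts} → Chain u ts → V G
  chainEnd (final r _ _) = End G r
  chainEnd (_ ∷ c)       = chainEnd c

  chainLength : ∀ {u ts} → Chain u ts → ℕ
  chainLength (final r _ _) = len G r
  chainLength (h ∷ c)       = len G (Hop.approach h) + len G (Hop.route h) + chainLength c

  chain-DistLe : ∀ {u ts} (c : Chain u ts) → DistLe G u (chainEnd c) (chainLength c)
  chain-DistLe (final r refl _) = DistLe-walk r
  chain-DistLe (h ∷ c) with Hop.approach-start h | Hop.joins h | Hop.route-end h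
  ... | refl | joins | refl =
    DistLe-trans (DistLe-trans (DistLe-walk (Hop.approach h)) (subst (λ x → DistLe G x _ _) (sym joins) (DistLe-walk (Hop.route h))))
                 (chain-DistLe c)

  unroll : ∀ ts (R : Fin (suc (length ts)) → Walk G) (Q : Fin (length ts) → Walk G) →
    (∀ i → End G (R (inject₁ i)) ≡ Start G (Q i)) →
    (∀ i → End G (Q i) ≡ Start G (R (suc i))) →
    (∀ i p dir → List.lookup ts i ≡ (p , dir) → SubpathDir G dir (Q i) (path p)) →
    (∀ i → len G (R i) ≤ ρℓ) →
    (∀ i → (2 * k + 3) * ρℓ < len G (Q i)) →
    Σ (Chain (Start G (R zero)) ts) λ c →
      chainEnd c ≡ End G (R (fromℕ (length ts))) ×
      chainLength c ≡ sumFin (suc (length ts)) (λ i → len G (R i)) + sumFin (length ts) (λ i → len G (Q i))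
  unroll []              R Q linkIn linkOut onPath shortR longQ =
    final (R zero) refl (shortR zero) , refl , sym (trans (+-identityʳ _) (+-identityʳ _))
  unroll ((p , dir) ∷ ts) R Q linkIn linkOut onPath shortR longQ
    with unroll ts (λ i → R (suc i)) (λ i → Q (suc i)) (λ i → linkIn (suc i)) (λ i → linkOut (suc i))
                (λ i → onPath (suc i)) (λ i → shortR (suc i)) (λ i → longQ (suc i))
  ... | c , end≡ , length≡ = hop ∷ c , end≡ ,
      trans (cong (len G (R zero) + len G (Q zero) +_) length≡) (interchange (len G (R zero)) (len G (Q zero)) _ _)
    where
    hop : Hop (Start G (R zero)) (Start G (R (suc zero))) p dir
    hop = record
      { approach = R zero ; route = Q zero ; approach-start = refl ; joins = linkIn zero ; route-end = linkOut zero
      ; on-path = onPath zero p dir refl ; approach-short = shortR zero ; route-long = longQ zero }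

  toChain : (C : Snappath G 𝒫 ℓ) → ∀ {ts} → Snappath.type C ≡ ts →
    Σ (Chain (Snappath.sStart C) ts) λ c → chainEnd c ≡ Snappath.sEnd C × chainLength c ≡ Snappath.sLen C
  toChain C refl = unroll type R Q linkIn linkOut onPath shortR longQ
    where open Snappath C

  length-type≤k : (C : Snappath G 𝒫 ℓ) → length (Snappath.type C) ≤ k
  length-type≤k C = decidable-stable (length type ≤? k) ≤k
    where
    open Snappath C
    pathIndex : Fin (length type) → Fin k
    pathIndex i = proj₁ (List.lookup type i)
    on : ∀ i → Subpath G (Q i) (path (pathIndex i))
    on i = proj₂ (List.lookup type i) , onPath i _ _ refl
    ≤k : ¬ ¬ length type ≤ k
    ≤k >k with pigeonhole (≰⇒> >k) pathIndex
    ... | i , j , i<j , same =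
      Fin-<-irrefl (atMostOne (pathIndex i) i j (on i) (subst (Subpath G (Q j) ∘ path) (sym same) (on j))) i<j

module Runs (G : Graph) {k ρ : ℕ} (𝒫 : GeodesicCover G k ρ) (ℓ : ℕ) (s : V G) where
  open Walks G
  open Chains G 𝒫 ℓ
  open GeodesicLine using (at; size; along; no-shortcut)

  δ : ℕ
  δ = 4 * k * ρ

  prefix-almost-shortest : ∀ {E L u ts t n} (c : Chain u ts) → chainEnd c ≡ E → t + chainLength c ≡ L →
    (∀ {n} → DistLe G s E n → L ≤ n + δ) → DistLe G s u n → t ≤ n + δ
  prefix-almost-shortest {t = t} {n} c refl refl almost-shortest su =
    +-cancelʳ-≤ (chainLength c) t (n + δ)
      (subst (t + chainLength c ≤_) (xy∙z≈xz∙y n (chainLength c) δ) (almost-shortest (DistLe-trans su (chain-DistLe c))))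

  -- A snappath of length L from s to E, of which a prefix of length walked has been traversed,
  -- leaving the chain c; shortcut is the length of a walk from s to the current vertex.
  record Runner (E : V G) (L : ℕ) {u ts} (c : Chain u ts) : Set where
    field
      ends            : chainEnd c ≡ E
      walked          : ℕ
      total           : walked + chainLength c ≡ L
      shortcut        : ℕ
      shortcut-walk   : DistLe G s u shortcut
      shortcut≤walked : shortcut ≤ walked
      almost-shortest : ∀ {n} → DistLe G s E n → L ≤ n + δ

    walked≤shortcut+δ : walked ≤ shortcut + δ
    walked≤shortcut+δ = prefix-almost-shortest c ends total almost-shortest shortcut-walk

  -- The current vertices sit at positions posX and posY of the geodesic last traversed
  -- (initially both at s), and their shortcuts, measured relative to these positions, agree up to M.
  record Aligned {E E′ L L′ u u′ ts ts′} {c : Chain u ts} {c′ : Chain u′ ts′}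
                 (X : Runner E L c) (Y : Runner E′ L′ c′) (M : ℕ) : Set where
    field
      posX posY gap : ℕ
      gap-walk      : DistLe G u u′ gap
      gap-pos       : posY ≡ posX + gap ⊎ posX ≡ posY + gap
      lagXY         : Lag M (Runner.shortcut X) posX (Runner.shortcut Y) posY
      lagYX         : Lag M (Runner.shortcut Y) posY (Runner.shortcut X) posX

  Aligned-swap : ∀ {E E′ L L′ u u′ ts ts′ M} {c : Chain u ts} {c′ : Chain u′ ts′} {X : Runner E L c} {Y : Runner E′ L′ c′} →
    Aligned X Y M → Aligned Y X M
  Aligned-swap A = record
    { posX = posY ; posY = posX ; gap = gap ; gap-walk = DistLe-sym gap-walk ; gap-pos = ⊎-swap gap-pos
    ; lagXY = lagYX ; lagYX = lagXY }
    where open Aligned A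

  -- A runner about to take a hop on Λ: its approach walk joins Λ at entry, then it follows Λ for route steps.
  record Entry (Λ : GeodesicLine) : Set where
    field
      shortcut walked approach entry route : ℕ
      reach                : DistLe G s (at Λ entry) (shortcut + approach)
      approach-short       : approach ≤ ρℓ
      route-long           : (2 * k + 3) * ρℓ < route
      fits                 : entry + route ≤ size Λ
      shortcut≤walked      : shortcut ≤ walked
      exit-almost-shortest : ∀ {n} → DistLe G s (at Λ (entry + route)) n → walked + approach + route ≤ n + δ

    exit : ℕ
    exit = entry + route

    entry≤size : entry ≤ size Λ
    entry≤size = ≤-trans (m≤m+n entry route) fits

  open Entry

  record Exit {Λ} (I : Entry Λ) : Set where
    field
      shortcut′        : ℕ
      reach′           : DistLe G s (at Λ (exit I)) shortcut′
      shortcut′≤walked : shortcut′ ≤ walked I + approach I + route I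

  open Exit

  own-exit : ∀ {Λ} (I : Entry Λ) → Exit I
  own-exit {Λ} I = record
    { shortcut′        = shortcut I + approach I + route I
    ; reach′           = DistLe-trans (reach I) (along Λ (entry I) (route I) (fits I))
    ; shortcut′≤walked = +-monoˡ-≤ (route I) (+-monoˡ-≤ (approach I) (shortcut≤walked I))
    }

  record Crossing {Λ} (I J : Entry Λ) (M : ℕ) : Set where
    field
      exitI : Exit I
      exitJ : Exit J
      lagIJ : Lag M (shortcut′ exitI) (exit I) (shortcut′ exitJ) (exit J)
      lagJI : Lag M (shortcut′ exitJ) (exit J) (shortcut′ exitI) (exit I)

  Crossing-swap : ∀ {Λ} {I J : Entry Λ} {M} → Crossing I J M → Crossing J I M
  Crossing-swap C = record { exitI = exitJ ; exitJ = exitI ; lagIJ = lagJI ; lagJI = lagIJ }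
    where open Crossing C

  cross-overlapping : ∀ {Λ} (I J : Entry Λ) {d} M →
    Lag 0 (shortcut I + approach I) (entry I) (shortcut J + approach J) (entry J) →
    entry I + d ≡ exit J → Crossing I J M
  cross-overlapping {Λ} I J {d} M ahead I-enters-first = record
    { exitI = own-exit I
    ; exitJ = record
      { shortcut′        = shortcut I + approach I + d
      ; reach′           = subst (λ x → DistLe G s (at Λ x) (via + d)) I-enters-first
                             (DistLe-trans (reach I) (along Λ (entry I) d (subst (_≤ size Λ) (sym I-enters-first) (fits J))))
      ; shortcut′≤walked = shortcut-via-ahead {e = shortcut I} {r = approach I} ahead I-enters-first (shortcut≤walked J)
      }
    ; lagIJ = subst (Lag M (via + route I) (entry I + route I) (via + d)) I-enters-first
                  (Lag-shift (route I) d (Lag-refl M via (entry I)))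
    ; lagJI = subst (λ x → Lag M (via + d) x (via + route I) (entry I + route I)) I-enters-first
                  (Lag-shift d (route I) (Lag-refl M via (entry I)))
    }
    where
    via : ℕ
    via = shortcut I + approach I

  cross-disjoint : ∀ {Λ} (I J : Entry Λ) {d g pI pJ M} →
    2 * ρℓ + M + δ ≤ (2 * k + 3) * ρℓ + (2 * k + 3) * ρℓ →
    Lag 0 (shortcut I + approach I) (entry I) (shortcut J + approach J) (entry J) →
    exit J + d ≡ entry I →
    entry I ≤ entry J + (approach J + g + approach I) →
    pJ ≡ pI + g ⊎ pI ≡ pJ + g →
    Lag M (shortcut I) pI (shortcut J) pJ → Lag M (shortcut J) pJ (shortcut I) pI →
    Crossing I J (2 * ρℓ + M)
  cross-disjoint {Λ} I J {d} {g} {M = M} room ahead J-leaves-first geodesic orient lagIJ lagJI = record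
    { exitI = own-exit I
    ; exitJ = own-exit J
    ; lagIJ = Lag-shift (route I) (route J) (Lag-mono z≤n ahead)
    ; lagJI = Lag-shift (route J) (route I) (behind orient lagIJ lagJI)
    }
    where
    back : DistLe G s (at Λ (exit J)) (shortcut I + approach I + d)
    back = DistLe-trans (reach I) (DistLe-sym
             (subst (λ x → DistLe G (at Λ (exit J)) (at Λ x) d) J-leaves-first
               (along Λ (exit J) d (subst (_≤ size Λ) (sym J-leaves-first) (entry≤size I)))))
    detour : shortcut J + approach J + route J ≤ shortcut I + approach I + d + δ
    detour = ≤-trans (+-monoˡ-≤ (route J) (+-monoˡ-≤ (approach J) (shortcut≤walked J))) (exit-almost-shortest J back)
    behind : ∀ {pI pJ} → pJ ≡ pI + g ⊎ pI ≡ pJ + g →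
      Lag M (shortcut I) pI (shortcut J) pJ → Lag M (shortcut J) pJ (shortcut I) pI →
      Lag (2 * ρℓ + M) (shortcut J + approach J) (entry J) (shortcut I + approach I) (entry I)
    behind (inj₂ refl) _     lagJI = Lag-across-approach {e = shortcut I} {shortcut J} geodesic (Lag-gap lagJI) (approach-short J)
    -- J was ahead on the previous geodesic but its route ends before I enters. Walking back from I's
    -- entry to J's exit then shows 2 · route J ≤ 2ρℓ + M + δ, contradicting route-long.
    behind (inj₁ refl) lagIJ _     = ⊥-elim (<⇒≱ (+-mono-< (route-long J) (route-long J)) (≤-trans
      (route-bounded {e = shortcut I} {shortcut J} {approach I} {approach J} {entry J}
                     (subst (_≤ _) (sym J-leaves-first) geodesic) (Lag-gap lagIJ) detour (approach-short I))
      room))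

  cross-ahead : ∀ {Λ} (I J : Entry Λ) {g pI pJ M} →
    2 * ρℓ + M + δ ≤ (2 * k + 3) * ρℓ + (2 * k + 3) * ρℓ →
    Lag 0 (shortcut I + approach I) (entry I) (shortcut J + approach J) (entry J) →
    entry I ≤ entry J + (approach J + g + approach I) →
    pJ ≡ pI + g ⊎ pI ≡ pJ + g →
    Lag M (shortcut I) pI (shortcut J) pJ → Lag M (shortcut J) pJ (shortcut I) pI →
    Crossing I J (2 * ρℓ + M)
  cross-ahead I J room ahead geodesic orient lagIJ lagJI with difference (entry I) (exit J)
  ... | inj₁ (_ , I-enters-first) = cross-overlapping I J _ ahead I-enters-first
  ... | inj₂ (_ , J-leaves-first) = cross-disjoint I J room ahead J-leaves-first geodesic orient lagIJ lagJI

  cross : ∀ {Λ} (I J : Entry Λ) {g pI pJ M} →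
    2 * ρℓ + M + δ ≤ (2 * k + 3) * ρℓ + (2 * k + 3) * ρℓ →
    entry I ≤ entry J + (approach J + g + approach I) →
    entry J ≤ entry I + (approach I + g + approach J) →
    pJ ≡ pI + g ⊎ pI ≡ pJ + g →
    Lag M (shortcut I) pI (shortcut J) pJ → Lag M (shortcut J) pJ (shortcut I) pI →
    Crossing I J (2 * ρℓ + M)
  cross I J room geodesicIJ geodesicJI orient lagIJ lagJI
    with Lag-total (shortcut I + approach I) (entry I) (shortcut J + approach J) (entry J)
  ... | inj₁ I-ahead = cross-ahead I J room I-ahead geodesicIJ orient lagIJ lagJI
  ... | inj₂ J-ahead = Crossing-swap (cross-ahead J I room J-ahead geodesicJI (⊎-swap orient) lagJI lagIJ)

  hop-total : ∀ {E L u v p dir ts} (h : Hop u v p dir) {c : Chain v ts} (X : Runner E L (h ∷ c)) →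
    Runner.walked X + len G (Hop.approach h) + len G (Hop.route h) + chainLength c ≡ L
  hop-total h {c} X = trans (regroup (Runner.walked X) (len G (Hop.approach h)) (len G (Hop.route h)) (chainLength c)) (Runner.total X)
    where
    regroup : ∀ t r q l → t + r + q + l ≡ t + (r + q + l)
    regroup = solve-∀

  enter : ∀ {E L u v p dir ts} (h : Hop u v p dir) {c : Chain v ts} → Runner E L (h ∷ c) → Entry (line p dir)
  enter h {c} X = record
    { shortcut             = Runner.shortcut X
    ; walked               = Runner.walked X
    ; approach             = len G (Hop.approach h)
    ; entry                = Hop.entry h
    ; route                = len G (Hop.route h)
    ; reach                = DistLe-trans (Runner.shortcut-walk X) (Hop.approach-DistLe h)
    ; approach-short       = Hop.approach-short h
    ; route-long           = Hop.route-long h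
    ; fits                 = Segment.fits (Hop.placement h)
    ; shortcut≤walked      = Runner.shortcut≤walked X
    ; exit-almost-shortest = λ w → prefix-almost-shortest c (Runner.ends X) (hop-total h X) (Runner.almost-shortest X)
                                     (subst (λ x → DistLe G s x _) (Hop.route-exit h) w)
    }

  leave : ∀ {E L u v p dir ts} (h : Hop u v p dir) {c : Chain v ts} (X : Runner E L (h ∷ c)) → Exit (enter h X) → Runner E L c
  leave h X o = record
    { ends            = Runner.ends X
    ; walked          = Runner.walked X + len G (Hop.approach h) + len G (Hop.route h)
    ; total           = hop-total h X
    ; shortcut        = shortcut′ o
    ; shortcut-walk   = subst (λ x → DistLe G s x (shortcut′ o)) (Hop.route-exit h) (reach′ o)
    ; shortcut≤walked = shortcut′≤walked o
    ; almost-shortest = Runner.almost-shortest X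
    }

  entries-DistLe : ∀ {u u′ v v′ p dir g} (h : Hop u v p dir) (h′ : Hop u′ v′ p dir) → DistLe G u u′ g →
    DistLe G (at (line p dir) (Hop.entry h)) (at (line p dir) (Hop.entry h′))
             (len G (Hop.approach h) + g + len G (Hop.approach h′))
  entries-DistLe h h′ uu′ = DistLe-trans (DistLe-trans (DistLe-sym (Hop.approach-DistLe h)) uu′) (Hop.approach-DistLe h′)

  advance : ∀ {E E′ L L′ u u′ v v′ p dir ts M} (h : Hop u v p dir) (h′ : Hop u′ v′ p dir) {c : Chain v ts} {c′ : Chain v′ ts}
    (X : Runner E L (h ∷ c)) (Y : Runner E′ L′ (h′ ∷ c′)) →
    2 * ρℓ + M + δ ≤ (2 * k + 3) * ρℓ + (2 * k + 3) * ρℓ → Aligned X Y M →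
    Σ (Runner E L c) λ X′ → Σ (Runner E′ L′ c′) λ Y′ → Aligned X′ Y′ (2 * ρℓ + M)
  advance {p = p} {dir} h h′ X Y room A = leave h X exitI , leave h′ Y exitJ , record
    { posX     = exit I
    ; posY     = exit J
    ; gap      = proj₁ exit-gap
    ; gap-walk = subst₂ (λ x y → DistLe G x y (proj₁ exit-gap)) (Hop.route-exit h) (Hop.route-exit h′) (proj₁ (proj₂ exit-gap))
    ; gap-pos  = proj₂ (proj₂ exit-gap)
    ; lagXY    = lagIJ
    ; lagYX    = lagJI
    }
    where
    open Aligned A
    Λ : GeodesicLine
    Λ = line p dir
    I J : Entry Λ
    I = enter h X
    J = enter h′ Y
    exit-gap : ∃ λ g → DistLe G (at Λ (exit I)) (at Λ (exit J)) g × (exit J ≡ exit I + g ⊎ exit I ≡ exit J + g)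
    exit-gap = GeodesicLine.gap Λ (fits I) (fits J)
    open Crossing (cross I J room
      (no-shortcut Λ (entry≤size J) (entry≤size I) (entries-DistLe h′ h (DistLe-sym gap-walk)))
      (no-shortcut Λ (entry≤size I) (entry≤size J) (entries-DistLe h h′ gap-walk))
      gap-pos lagXY lagYX)

  finish-ordered : ∀ {E E′ L L′ u u′ γ M} (c : Chain u []) (c′ : Chain u′ []) {X : Runner E L c} {Y : Runner E′ L′ c′}
    (A : Aligned X Y M) → Aligned.posY A ≡ Aligned.posX A + Aligned.gap A → L′ ≤ L + γ →
    DistLe G E E′ (γ + δ + M + 2 * ρℓ)
  finish-ordered {γ = γ} {M} (final r refl r-short) (final r′ refl _) {X} {Y} A ordered L′≤L+γ =
    DistLe-mono bound (subst₂ (λ x y → DistLe G x y (len G r + gap + len G r′)) (Runner.ends X) (Runner.ends Y)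
      (DistLe-trans (DistLe-trans (DistLe-sym (DistLe-walk r)) gap-walk) (DistLe-walk r′)))
    where
    open Aligned A
    bound : len G r + gap + len G r′ ≤ γ + δ + M + 2 * ρℓ
    bound = final-gap (Lag-gap (subst (Lag M (Runner.shortcut X) posX (Runner.shortcut Y)) ordered lagXY))
                      (Runner.shortcut≤walked Y) (Runner.walked≤shortcut+δ X)
                      (subst₂ (λ a b → a ≤ b + γ) (sym (Runner.total Y)) (sym (Runner.total X)) L′≤L+γ) r-short

  finish : ∀ {E E′ L L′ u u′ γ M} (c : Chain u []) (c′ : Chain u′ []) {X : Runner E L c} {Y : Runner E′ L′ c′} →
    Aligned X Y M → L′ ≤ L + γ → L ≤ L′ + γ → DistLe G E E′ (γ + δ + M + 2 * ρℓ)
  finish c c′ A L′≤L+γ L≤L′+γ with Aligned.gap-pos A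
  ... | inj₁ ordered = finish-ordered c c′ A ordered L′≤L+γ
  ... | inj₂ ordered = DistLe-sym (finish-ordered c′ c (Aligned-swap A) ordered L≤L′+γ)

  follow : ∀ {E E′ L L′ u u′ ts γ} i → i + length ts ≤ k → (c : Chain u ts) (c′ : Chain u′ ts)
    {X : Runner E L c} {Y : Runner E′ L′ c′} → Aligned X Y (i * (2 * ρℓ)) → L′ ≤ L + γ → L ≤ L′ + γ →
    DistLe G E E′ (γ + δ + k * (2 * ρℓ) + 2 * ρℓ)
  follow {γ = γ} i i≤k c@(final _ _ _) c′@(final _ _ _) A L′≤L+γ L≤L′+γ =
    DistLe-mono (+-monoˡ-≤ (2 * ρℓ) (+-monoʳ-≤ (γ + δ) (*-monoˡ-≤ (2 * ρℓ) (subst (_≤ k) (+-identityʳ i) i≤k))))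
      (finish c c′ A L′≤L+γ L≤L′+γ)
  follow {ts = _ ∷ ts} i i+n≤k (h ∷ c) (h′ ∷ c′) {X} {Y} A L′≤L+γ L≤L′+γ =
    follow (suc i) 1+i+n≤k c c′ (proj₂ (proj₂ (advance h h′ X Y (lag-room i<k (4kρ≤2kρℓ k ρ ℓ)) A))) L′≤L+γ L≤L′+γ
    where
    1+i+n≤k : suc i + length ts ≤ k
    1+i+n≤k = subst (_≤ k) (+-suc i (length ts)) i+n≤k
    i<k : suc i ≤ k
    i<k = ≤-trans (m≤m+n (suc i) (length ts)) 1+i+n≤k

  start : ∀ {E L u ts} (c : Chain u ts) → s ≡ u → chainEnd c ≡ E → chainLength c ≡ L →
    AlmostShortest G δ s E L → Runner E L c
  start c s≡u ends length almost = record
    { ends            = ends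
    ; walked          = 0
    ; total           = length
    ; shortcut        = 0
    ; shortcut-walk   = subst (λ x → DistLe G s x 0) s≡u (DistLe-refl s)
    ; shortcut≤walked = z≤n
    ; almost-shortest = AlmostShortest-≤ almost
    }

  ends-close : (C D : Snappath G 𝒫 ℓ) {γ : ℕ} →
    s ≡ Snappath.sStart C → s ≡ Snappath.sStart D → Snappath.type C ≡ Snappath.type D →
    AlmostShortest G δ s (Snappath.sEnd C) (Snappath.sLen C) →
    AlmostShortest G δ s (Snappath.sEnd D) (Snappath.sLen D) →
    Snappath.sLen D ≤ Snappath.sLen C + γ → Snappath.sLen C ≤ Snappath.sLen D + γ →
    DistLe G (Snappath.sEnd C) (Snappath.sEnd D) (γ + δ + k * (2 * ρℓ) + 2 * ρℓ)
  ends-close C D s≡C s≡D same-type C-almost D-almost D≤C+γ C≤D+γ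
    with toChain C refl | toChain D (sym same-type)
  ... | c , c-end , c-length | c′ , c′-end , c′-length = follow 0 (length-type≤k C) c c′ aligned D≤C+γ C≤D+γ
    where
    aligned : Aligned (start c s≡C c-end c-length C-almost) (start c′ s≡D c′-end c′-length D-almost) 0
    aligned = record
      { posX = 0 ; posY = 0 ; gap = 0
      ; gap-walk = subst₂ (λ x y → DistLe G x y 0) s≡C s≡D (DistLe-refl s)
      ; gap-pos = inj₁ refl
      ; lagXY = lag z≤n
      ; lagYX = lag z≤n
      }

corollary4p3 : (G : Graph) (k ρ : ℕ) (𝒫 : GeodesicCover G k ρ) (ℓ : ℕ) → ℓ ≤ k →
    (C D : Snappath G 𝒫 ℓ) (γ : ℕ) →
    Snappath.sStart C ≡ Snappath.sStart D →
    Snappath.type C ≡ Snappath.type D →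
    ∣ Snappath.sLen C - Snappath.sLen D ∣ ≤ γ →
    AlmostShortest G (4 * k * ρ) (Snappath.sStart C) (Snappath.sEnd C) (Snappath.sLen C) →
    AlmostShortest G (4 * k * ρ) (Snappath.sStart D) (Snappath.sEnd D) (Snappath.sLen D) →
    DistLe G (Snappath.sEnd C) (Snappath.sEnd D)
      (γ + k * (4 * k * ρ + 2 * rhoSeq k ρ ℓ + 2 * k * rhoSeq k ρ ℓ) + (6 * k + 4) * rhoSeq k ρ ℓ)
-- The bound holds for every ℓ.
corollary4p3 G k ρ 𝒫 ℓ _ C D γ same-start same-type ∣C-D∣≤γ C-almost D-almost =
  DistLe-mono (corollary-bound {γ} {k} {ρ} (4kρ≤2kρℓ k ρ ℓ))
    (ends-close C D refl same-start same-type C-almost D-almost′ D≤C+γ C≤D+γ)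
  where
  open Walks G using (DistLe-mono)
  open Runs G 𝒫 ℓ (Snappath.sStart C) using (ends-close)
  D-almost′ : AlmostShortest G (4 * k * ρ) (Snappath.sStart C) (Snappath.sEnd D) (Snappath.sLen D)
  D-almost′ = subst (λ x → AlmostShortest G (4 * k * ρ) x (Snappath.sEnd D) (Snappath.sLen D)) (sym same-start) D-almost
  D≤C+γ : Snappath.sLen D ≤ Snappath.sLen C + γ
  D≤C+γ = ≤-trans (m≤n+∣n-m∣ (Snappath.sLen D) (Snappath.sLen C)) (+-monoʳ-≤ (Snappath.sLen C) ∣C-D∣≤γ)
  C≤D+γ : Snappath.sLen C ≤ Snappath.sLen D + γ
  C≤D+γ = ≤-trans (m≤n+∣m-n∣ (Snappath.sLen C) (Snappath.sLen D)) (+-monoʳ-≤ (Snappath.sLen D) ∣C-D∣≤γ)
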